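{- Let $r/s>1$ be a rational number with regular continued fraction expansion $[a_1,\ldots,a_{2m}]$, let $n=a_1+\cdots+a_{2m}+2$, and let $\frac{\mathcal R(q)}{\mathcal S(q)}=\left[\frac rs\right]_q$. Then: (i) $\mathcal R(q)=1+\rho_1q+\rho_2q^2+\cdots+\rho_{n-4}q^{n-4}+q^{n-3}$, where for every $i$, $\rho_i$ is the number of $i$-vertex closures of the oriented graph $\mathcal G_{r/s}$; (ii) $\mathcal S(q)=1+\sigma_1q+\sigma_2q^2+\cdots+\sigma_{n-a_1-4}q^{n-a_1-4}+q^{n-a_1-3}$, where for every $i$, $\sigma_i$ is the number of $i$-vertex closures of the oriented graph $\mathcal G'_{r/s}$.
   Context: $q$ is a formal variable, $[a]_q=1+q+\cdots+q^{a-1}$, $[a]_{q^{ -1}}=1+q^{ -1}+\cdots+q^{ -(a-1)}$. Every rational $r/s>1$ ($r,s$ coprime positive integers) has a unique expansion $r/s=[a_1,\ldots,a_{2m}]=a_1+\cfrac{1}{a_2+\cfrac{1}{\ddots+\cfrac{1}{a_{2m}}}}$ with an even number of integers $a_i\ge 1$. Its $q$-deformation is $$\left[\tfrac rs\right]_q=[a_1]_q+\cfrac{q^{a_1}}{[a_2]_{q^{ -1}}+\cfrac{q^{ -a_2}}{[a_3]_q+\cfrac{q^{a_3}}{\ddots\,[a_{2m-1}]_q+\cfrac{q^{a_{2m-1}}}{[a_{2m}]_{q^{ -1}}}}}}$$ (odd-indexed terms $[a_i]_q$ followed by numerator $q^{a_i}$, even-indexed terms $[a_i]_{q^{ -1}}$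 followed by numerator $q^{ -a_i}$), written as $\frac{\mathcal R}{\mathcal S}$ with $\mathcal R,\mathcal S\in\mathbb Z[q]$ coprime, $\mathcal R(1)=r$, $\mathcal S(1)=s$. The graph $\mathcal G_{r/s}$: take $n-3$ vertices $v_1,\ldots,v_{n-3}$ in a row and the $n-4$ edges $e_j=\{v_j,v_{j+1}\}$, $1\le j\le n-4$. Orient them, reading left to right, as follows: the first $a_1-1$ edges point left (from $v_{j+1}$ to $v_j$), the next $a_2$ edges point right (from $v_j$ to $v_{j+1}$), the next $a_3$ point left, the next $a_4$ point right, and so on alternately, the last $a_{2m}-1$ edges pointing right. The graph $\mathcal G'_{r/s}$ is obtained from $\mathcal G_{r/s}$ by deleting the first $a_1$ vertices $v_1,\ldots,v_{a_1}$ (and hence the first $a_1$ edges); it has $n-3-a_1$ vertices. A closure of an oriented graph is a set $\mathcal C$ of vertices such that no edge goes from a vertex of $\mathcal C$ to a vertex outside $\mathcal C$; an $i$-vertex closure is a closure with exactly $i$ elements (the empty set is the unique $0$-vertex closure). -}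

module Defs where

open import Data.Bool using (Bool; true; false; not)
open import Data.Nat as ℕ using (ℕ; zero; suc; _∸_)
open import Data.Integer as ℤ using (ℤ; +_)
open import Data.List using (List; []; _∷_; _++_; replicate; length; filter; foldr; map; drop)
open import Data.Maybe using (Maybe; just; nothing)
import Data.Maybe.Properties as MaybeP
open import Data.Product using (_×_; _,_; proj₁; proj₂; Σ)
open import Data.Sum using (_⊎_)
open import Data.Vec using (Vec; []; _∷_)
open import Data.Fin using (Fin; toℕ)
open import Data.Fin.Subset using (Subset; _∈_; ∣_∣)
open import Data.Fin.Subset.Properties using (_∈?_)
open import Data.Fin.Properties using (all?)
open import Relation.Binary.PropositionalEquality using (_≡_)
open import Relation.Nullary using (Dec; yes; no)
open import Relation.Nullary.Decidable using (_×-dec_; _⊎-dec_; _→-dec_)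

-- Polynomials in ℤ[q]: coefficient lists, constant term first.

Poly : Set
Poly = List ℤ

coeff : Poly → ℕ → ℤ
coeff []       _       = + 0
coeff (c ∷ _)  zero    = c
coeff (_ ∷ p)  (suc i) = coeff p i

-- equality of polynomials (coefficientwise; trailing zeros irrelevant)
_≈P_ : Poly → Poly → Set
p ≈P r = ∀ i → coeff p i ≡ coeff r i

infixl 6 _+P_
infixl 7 _*P_

_+P_ : Poly → Poly → Poly
[]      +P r       = r
p       +P []      = p
(c ∷ p) +P (d ∷ r) = (c ℤ.+ d) ∷ (p +P r)

_*P_ : Poly → Poly → Poly
[]      *P r = []
(c ∷ p) *P r = map (c ℤ.*_) r +P (+ 0 ∷ (p *P r))

oneP : Poly
oneP = + 1 ∷ []

qPow : ℕ → Poly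
qPow a = replicate a (+ 0) ++ (+ 1 ∷ [])

qInt : ℕ → Poly
qInt a = replicate a (+ 1)

eval1 : Poly → ℤ
eval1 = foldr ℤ._+_ (+ 0)

IsUnit : Poly → Set
IsUnit D = Σ Poly λ U → (D *P U) ≈P oneP

CoprimeP : Poly → Poly → Set
CoprimeP R S = ∀ D X Y → R ≈P (D *P X) → S ≈P (D *P Y) → IsUnit D

-- Laurent polynomials: (k , p) represents q^(-k) · p

Laurent : Set
Laurent = ℕ × Poly

_+L_ : Laurent → Laurent → Laurent
(k , p) +L (l , r) = (k ℕ.+ l , (qPow l *P p) +P (qPow k *P r))

_*L_ : Laurent → Laurent → Laurent
(k , p) *L (l , r) = (k ℕ.+ l , p *P r)

oneL : Laurent
oneL = (0 , oneP)

-- odd-indexed term (flag true): [a]_q, numerator q^a;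
-- even-indexed term (flag false): [a]_{q^{-1}} = q^{-(a-1)} [a]_q, numerator q^{-a}.
termL : Bool → ℕ → Laurent
termL true  a = (0 , qInt a)
termL false a = (a ∸ 1 , qInt a)

numerL : Bool → ℕ → Laurent
numerL true  a = (0 , qPow a)
numerL false a = (a , oneP)

-- q-deformed continued fraction, as a (numerator , denominator) pair of
-- Laurent polynomials: x = T + Num / (N / D) = (T·N + Num·D) / N.
cfqFrom : Bool → List ℕ → Laurent × Laurent
cfqFrom b []           = (oneL , oneL)      -- junk, never used (length ≥ 2)
cfqFrom b (a ∷ [])     = (termL b a , oneL)
cfqFrom b (a ∷ c ∷ as) with cfqFrom (not b) (c ∷ as)
... | (N , D) = ((termL b a *L N) +L (numerL b a *L D) , N)

cfq : List ℕ → Laurent × Laurent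
cfq = cfqFrom true

-- R / S equals the fraction (q^(-k) p) / (q^(-l) d) of Laurent polynomials
SameFrac : Poly → Poly → Laurent × Laurent → Set
SameFrac R S ((k , p) , (l , d)) = (qPow k *P (R *P d)) ≈P (qPow l *P (S *P p))

cf : List ℕ → ℕ × ℕ
cf []           = (1 , 1)                  -- junk, never used
cf (a ∷ [])     = (a , 1)
cf (a ∷ c ∷ as) with cf (c ∷ as)
... | (N , D) = (a ℕ.* N ℕ.+ D , N)

-- A path graph is given by its number k of
-- vertices (Fin k, vertex j ↔ v_{j+1}) and a list of edge orientations:
-- the j-th entry (0-based) is the orientation of the edge between
-- vertex j and vertex j+1.

data Dir : Set where
  left right : Dir   -- left: from v_{j+1} to v_j ; right: from v_j to v_{j+1}

_≟D_ : (x y : Dir) → Dec (x ≡ y)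
left  ≟D left  = yes _≡_.refl
left  ≟D right = no λ ()
right ≟D left  = no λ ()
right ≟D right = yes _≡_.refl

dirAt : List Dir → ℕ → Maybe Dir
dirAt []       _       = nothing
dirAt (d ∷ _)  zero    = just d
dirAt (_ ∷ ds) (suc j) = dirAt ds j

Edge : ∀ {k} → List Dir → Fin k → Fin k → Set
Edge ds u v =
  (toℕ v ≡ suc (toℕ u) × dirAt ds (toℕ u) ≡ just right)
  ⊎ (toℕ u ≡ suc (toℕ v) × dirAt ds (toℕ v) ≡ just left)

edge? : ∀ {k} (ds : List Dir) (u v : Fin k) → Dec (Edge ds u v)
edge? ds u v =
  (toℕ v ℕ.≟ suc (toℕ u) ×-dec MaybeP.≡-dec _≟D_ (dirAt ds (toℕ u)) (just right))
  ⊎-dec (toℕ u ℕ.≟ suc (toℕ v) ×-dec MaybeP.≡-dec _≟D_ (dirAt ds (toℕ v)) (just left))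

IsClosure : ∀ {k} → List Dir → Subset k → Set
IsClosure ds C = ∀ u v → Edge ds u v → u ∈ C → v ∈ C

isClosure? : ∀ {k} (ds : List Dir) (C : Subset k) → Dec (IsClosure ds C)
isClosure? ds C =
  all? λ u → all? λ v → edge? ds u v →-dec (u ∈? C →-dec v ∈? C)

allSubsets : (k : ℕ) → List (Subset k)
allSubsets zero    = [] ∷ []
allSubsets (suc k) = map (true ∷_) (allSubsets k) ++ map (false ∷_) (allSubsets k)

numClosures : (k : ℕ) → List Dir → ℕ → ℕ
numClosures k ds i =
  length (filter (λ C → (∣ C ∣ ℕ.≟ i) ×-dec isClosure? ds C) (allSubsets k))

flipD : Dir → Dir
flipD left  = right
flipD right = left

blocks : Dir → List ℕ → List Dir
blocks d []       = []
blocks d (b ∷ bs) = replicate b d ++ blocks (flipD d) bs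

decHead : List ℕ → List ℕ
decHead []       = []
decHead (a ∷ as) = (a ∸ 1) ∷ as

decLast : List ℕ → List ℕ
decLast []           = []
decLast (a ∷ [])     = (a ∸ 1) ∷ []
decLast (a ∷ b ∷ as) = a ∷ decLast (b ∷ as)

-- orientations of G_{r/s}: a1-1 left, a2 right, a3 left, ..., a2m-1 right
dirsG : List ℕ → List Dir
dirsG as = blocks left (decHead (decLast as))

sumL : List ℕ → ℕ
sumL = foldr ℕ._+_ 0

nOf : List ℕ → ℕ
nOf as = sumL as ℕ.+ 2

headOr0 : List ℕ → ℕ
headOr0 []      = 0
headOr0 (a ∷ _) = a

-- G_{r/s}: n-3 vertices, orientations dirsG
-- G'_{r/s}: delete v_1..v_{a1} (and edges e_1..e_{a1}): n-3-a1 vertices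
dirsG' : List ℕ → List Dir
dirsG' as = drop (headOr0 as) (dirsG as)

-- Write I and O for the size-generating polynomials of the closures of an oriented path that
-- contain, resp. avoid, its first vertex.  Deleting the first vertex acts on (I , O) by
-- [[q,0],[1,1]] or [[q,q],[0,1]] according to the orientation of the first edge, so a block of a
-- equally oriented edges contributes q^a and [a]_q exactly as a term of the q-continued fraction
-- does.  Hence [r/s]_q = (I + O) / O for the path G_{r/s}, where O also counts the closures of
-- G'_{r/s}.  The transfer matrices have determinant q, so I + O and O are coprime up to a power of
-- q, which cancels because I + O has constant term 1.  Thus R = ±(I + O) and S = ±O, and R(1) = r
-- fixes the sign.

module Submission where

open import Defs
open import Data.Nat using (ℕ; _≤_; _<_; _*_; _∸_)
open import Data.Nat.Coprimality using (Coprime)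
open import Data.Integer using (+_)
open import Data.List using (List; length)
open import Data.List.Relation.Unary.All using (All)
open import Data.Product using (_×_; proj₁; proj₂)
open import Relation.Binary.PropositionalEquality using (_≡_)

open import Algebra.Bundles using (CommutativeRing)
import Algebra.Solver.Ring as RingSolver
open import Algebra.Solver.Ring.AlmostCommutativeRing
  using (AlmostCommutativeRing; _-Raw-AlmostCommutative⟶_)
open import Algebra.Structures using (IsCommutativeSemiring)
open import Data.Bool using (Bool; true; false; not)
open import Data.Empty using (⊥-elim)
open import Data.Fin using (Fin; zero; suc; toℕ)
open import Data.Fin.Subset using (Subset; _∈_; ∣_∣)
open import Data.Integer as ℤ using (ℤ; -[1+_])
import Data.Integer.Properties as ℤ
open import Data.Integer.Solver using (module +-*-Solver)
open import Data.List using ([]; _∷_; _++_; map; replicate; foldr; filter; drop)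
import Data.List.Properties as List
open import Data.List.Relation.Unary.All using ([]; _∷_)
import Data.List.Relation.Unary.All as All
open import Data.Maybe using (Maybe; just; nothing)
open import Data.Nat as ℕ using (zero; suc; s≤s; z≤n)
import Data.Nat.Properties as ℕ
open import Data.Product using (Σ; _,_)
open import Data.Sum using (_⊎_; inj₁; inj₂)
open import Data.Vec.Base using ([]; _∷_; here; there)
open import Level using (0ℓ)
open import Relation.Binary.Bundles using (Setoid)
open import Relation.Binary.PropositionalEquality
  using (_≢_; refl; sym; trans; cong; cong₂; subst; subst₂; module ≡-Reasoning)
open import Relation.Binary.Structures using (IsEquivalence)
open import Relation.Nullary using (¬_; yes; no; does)
open import Relation.Nullary.Decidable using (_×-dec_)
open import Relation.Unary using (Decidable; _≐_)

-- Polynomial arithmetic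

infix 4 _≋_

-- A record around _≈P_, so that both polynomials can be inferred from a proof.
record _≋_ (p r : Poly) : Set where
  constructor mk≋
  field at : p ≈P r
open _≋_

module PolyArithmetic where

  open +-*-Solver using (solve; _:+_; _:*_; _:=_; :-_; con)

  ≋-refl : ∀ {p} → p ≋ p
  ≋-refl = mk≋ λ _ → refl

  ≋-sym : ∀ {p r} → p ≋ r → r ≋ p
  ≋-sym h = mk≋ λ i → sym (at h i)

  ≋-trans : ∀ {p r s} → p ≋ r → r ≋ s → p ≋ s
  ≋-trans h k = mk≋ λ i → trans (at h i) (at k i)

  ≋-isEquivalence : IsEquivalence _≋_
  ≋-isEquivalence = record { refl = ≋-refl ; sym = ≋-sym ; trans = ≋-trans }

  ≋-setoid : Setoid 0ℓ 0ℓ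
  ≋-setoid = record { isEquivalence = ≋-isEquivalence }

  shift : Poly → Poly
  shift p = + 0 ∷ p

  negP : Poly → Poly
  negP = map (λ c → ℤ.- c)

  constP : ℤ → Poly
  constP c = c ∷ []

  coeff-+P : ∀ p r i → coeff (p +P r) i ≡ coeff p i ℤ.+ coeff r i
  coeff-+P []      r       i       = sym (ℤ.+-identityˡ _)
  coeff-+P (c ∷ p) []      i       = sym (ℤ.+-identityʳ _)
  coeff-+P (c ∷ p) (d ∷ r) zero    = refl
  coeff-+P (c ∷ p) (d ∷ r) (suc i) = coeff-+P p r i

  coeff-scale : ∀ c r i → coeff (map (c ℤ.*_) r) i ≡ c ℤ.* coeff r i
  coeff-scale c []      i       = sym (ℤ.*-zeroʳ c)
  coeff-scale c (d ∷ r) zero    = refl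
  coeff-scale c (d ∷ r) (suc i) = coeff-scale c r i

  coeff-negP : ∀ r i → coeff (negP r) i ≡ ℤ.- coeff r i
  coeff-negP []      i       = refl
  coeff-negP (d ∷ r) zero    = refl
  coeff-negP (d ∷ r) (suc i) = coeff-negP r i

  coeff-∷*P : ∀ c p r i → coeff ((c ∷ p) *P r) i ≡ c ℤ.* coeff r i ℤ.+ coeff (shift (p *P r)) i
  coeff-∷*P c p r i =
    trans (coeff-+P (map (c ℤ.*_) r) (shift (p *P r)) i)
          (cong (ℤ._+ coeff (shift (p *P r)) i) (coeff-scale c r i))

  shift-cong : ∀ {x y} → x ≋ y → shift x ≋ shift y
  shift-cong h = mk≋ λ { zero → refl ; (suc i) → at h i }

  shift-injective : ∀ {x y} → shift x ≋ shift y → x ≋ y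
  shift-injective h = mk≋ λ i → at h (suc i)

  +P-cong : ∀ {p p' r r'} → p ≋ p' → r ≋ r' → (p +P r) ≋ (p' +P r')
  +P-cong {p} {p'} {r} {r'} h k = mk≋ λ i →
    trans (coeff-+P p r i) (trans (cong₂ ℤ._+_ (at h i) (at k i)) (sym (coeff-+P p' r' i)))

  +P-congˡ : ∀ {x x'} y → x ≋ x' → (x +P y) ≋ (x' +P y)
  +P-congˡ y h = +P-cong h (≋-refl {y})

  +P-congʳ : ∀ x {y y'} → y ≋ y' → (x +P y) ≋ (x +P y')
  +P-congʳ x h = +P-cong (≋-refl {x}) h

  +P-comm : ∀ p r → (p +P r) ≋ (r +P p)
  +P-comm p r = mk≋ λ i →
    trans (coeff-+P p r i) (trans (ℤ.+-comm (coeff p i) _) (sym (coeff-+P r p i)))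

  +P-assoc : ∀ p r s → ((p +P r) +P s) ≋ (p +P (r +P s))
  +P-assoc p r s = mk≋ λ i → begin
    coeff ((p +P r) +P s) i              ≡⟨ coeff-+P (p +P r) s i ⟩
    coeff (p +P r) i ℤ.+ coeff s i       ≡⟨ cong (ℤ._+ coeff s i) (coeff-+P p r i) ⟩
    coeff p i ℤ.+ coeff r i ℤ.+ coeff s i ≡⟨ ℤ.+-assoc (coeff p i) _ _ ⟩
    coeff p i ℤ.+ (coeff r i ℤ.+ coeff s i) ≡⟨ cong (λ z → coeff p i ℤ.+ z) (coeff-+P r s i) ⟨
    coeff p i ℤ.+ coeff (r +P s) i       ≡⟨ coeff-+P p (r +P s) i ⟨
    coeff (p +P (r +P s)) i              ∎
    where open ≡-Reasoning

  +P-identityʳ : ∀ p → (p +P []) ≋ p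
  +P-identityʳ p = mk≋ λ i → trans (coeff-+P p [] i) (ℤ.+-identityʳ _)

  *P-zeroˡ : ∀ {p} r → p ≋ [] → (p *P r) ≋ []
  *P-zeroˡ {[]}    r h = ≋-refl
  *P-zeroˡ {c ∷ p} r h = mk≋ λ i →
    trans (coeff-∷*P c p r i)
          (trans (cong₂ ℤ._+_ (trans (cong (ℤ._* coeff r i) (at h 0)) (ℤ.*-zeroˡ (coeff r i)))
                              (at (shift-cong (*P-zeroˡ {p} r (mk≋ λ j → at h (suc j)))) i))
                 (shift-[] i))
    where
    shift-[] : ∀ i → + 0 ℤ.+ coeff (shift []) i ≡ + 0
    shift-[] zero    = refl
    shift-[] (suc i) = refl

  *P-congˡ : ∀ {p p'} r → p ≋ p' → (p *P r) ≋ (p' *P r)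
  *P-congˡ {[]}    {[]}      r h = ≋-refl
  *P-congˡ {[]}    {c' ∷ p'} r h = ≋-sym (*P-zeroˡ r (≋-sym h))
  *P-congˡ {c ∷ p} {[]}      r h = *P-zeroˡ r h
  *P-congˡ {c ∷ p} {c' ∷ p'} r h = mk≋ λ i →
    trans (coeff-∷*P c p r i)
          (trans (cong₂ ℤ._+_ (cong (ℤ._* coeff r i) (at h 0))
                              (at (shift-cong (*P-congˡ {p} {p'} r (mk≋ λ j → at h (suc j)))) i))
                 (sym (coeff-∷*P c' p' r i)))

  *P-congʳ : ∀ p {r r'} → r ≋ r' → (p *P r) ≋ (p *P r')
  *P-congʳ []      h = ≋-refl
  *P-congʳ (c ∷ p) {r} {r'} h = mk≋ λ i →
    trans (coeff-∷*P c p r i)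
          (trans (cong₂ ℤ._+_ (cong (c ℤ.*_) (at h i)) (at (shift-cong (*P-congʳ p h)) i))
                 (sym (coeff-∷*P c p r' i)))

  *P-cong : ∀ {p p' r r'} → p ≋ p' → r ≋ r' → (p *P r) ≋ (p' *P r')
  *P-cong {p' = p'} {r = r} h k = ≋-trans (*P-congˡ r h) (*P-congʳ p' k)

  *P-distribʳ : ∀ p p' r → ((p +P p') *P r) ≋ ((p *P r) +P (p' *P r))
  *P-distribʳ []      p'       r = ≋-refl
  *P-distribʳ (c ∷ p) []       r = ≋-sym (+P-identityʳ _)
  *P-distribʳ (c ∷ p) (d ∷ p') r = mk≋ λ i →
    trans (coeff-∷*P (c ℤ.+ d) (p +P p') r i)
    (trans (cong (λ z → (c ℤ.+ d) ℤ.* coeff r i ℤ.+ z) (at (shift-cong (*P-distribʳ p p' r)) i))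
    (trans (rearrange i)
    (sym (trans (coeff-+P ((c ∷ p) *P r) ((d ∷ p') *P r) i)
                (cong₂ ℤ._+_ (coeff-∷*P c p r i) (coeff-∷*P d p' r i))))))
    where
    rearrange : ∀ i → (c ℤ.+ d) ℤ.* coeff r i ℤ.+ coeff (shift ((p *P r) +P (p' *P r))) i
                    ≡ (c ℤ.* coeff r i ℤ.+ coeff (shift (p *P r)) i)
                      ℤ.+ (d ℤ.* coeff r i ℤ.+ coeff (shift (p' *P r)) i)
    rearrange zero = solve 3 (λ c d x → (c :+ d) :* x :+ con (+ 0)
                                       := (c :* x :+ con (+ 0)) :+ (d :* x :+ con (+ 0))) refl c d (coeff r 0)
    rearrange (suc j) rewrite coeff-+P (p *P r) (p' *P r) j =
      solve 5 (λ c d x u v → (c :+ d) :* x :+ (u :+ v) := (c :* x :+ u) :+ (d :* x :+ v))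
        refl c d (coeff r (suc j)) (coeff (p *P r) j) (coeff (p' *P r) j)

  *P-distribˡ : ∀ r p p' → (r *P (p +P p')) ≋ ((r *P p) +P (r *P p'))
  *P-distribˡ []      p p' = ≋-refl
  *P-distribˡ (c ∷ r) p p' = mk≋ λ i →
    trans (coeff-∷*P c r (p +P p') i)
    (trans (cong₂ ℤ._+_ (cong (c ℤ.*_) (coeff-+P p p' i)) (at (shift-cong (*P-distribˡ r p p')) i))
    (trans (rearrange i)
    (sym (trans (coeff-+P ((c ∷ r) *P p) ((c ∷ r) *P p') i)
                (cong₂ ℤ._+_ (coeff-∷*P c r p i) (coeff-∷*P c r p' i))))))
    where
    rearrange : ∀ i → c ℤ.* (coeff p i ℤ.+ coeff p' i) ℤ.+ coeff (shift ((r *P p) +P (r *P p'))) i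
                    ≡ (c ℤ.* coeff p i ℤ.+ coeff (shift (r *P p)) i)
                      ℤ.+ (c ℤ.* coeff p' i ℤ.+ coeff (shift (r *P p')) i)
    rearrange zero = solve 3 (λ c x y → c :* (x :+ y) :+ con (+ 0)
                                       := (c :* x :+ con (+ 0)) :+ (c :* y :+ con (+ 0))) refl c (coeff p 0) (coeff p' 0)
    rearrange (suc j) rewrite coeff-+P (r *P p) (r *P p') j =
      solve 5 (λ c x y u v → c :* (x :+ y) :+ (u :+ v) := (c :* x :+ u) :+ (c :* y :+ v))
        refl c (coeff p (suc j)) (coeff p' (suc j)) (coeff (r *P p) j) (coeff (r *P p') j)

  *P-zeroʳ : ∀ r → (r *P []) ≋ []
  *P-zeroʳ []      = ≋-refl
  *P-zeroʳ (c ∷ r) = mk≋ λ { zero → refl ; (suc i) → at (*P-zeroʳ r) i }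

  *P-∷ʳ : ∀ r c p → (r *P (c ∷ p)) ≋ (map (c ℤ.*_) r +P shift (r *P p))
  *P-∷ʳ []      c p = mk≋ λ { zero → refl ; (suc i) → refl }
  *P-∷ʳ (d ∷ r) c p = mk≋ λ
    { zero    → trans (ℤ.+-identityʳ _) (trans (ℤ.*-comm d c) (sym (ℤ.+-identityʳ _)))
    ; (suc i) → begin
        coeff (map (d ℤ.*_) p +P (r *P (c ∷ p))) i
          ≡⟨ coeff-+P (map (d ℤ.*_) p) (r *P (c ∷ p)) i ⟩
        coeff (map (d ℤ.*_) p) i ℤ.+ coeff (r *P (c ∷ p)) i
          ≡⟨ cong₂ ℤ._+_ (coeff-scale d p i) (trans (at (*P-∷ʳ r c p) i) (coeff-+P (map (c ℤ.*_) r) _ i)) ⟩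
        d ℤ.* coeff p i ℤ.+ (coeff (map (c ℤ.*_) r) i ℤ.+ coeff (shift (r *P p)) i)
          ≡⟨ cong (λ z → d ℤ.* coeff p i ℤ.+ (z ℤ.+ coeff (shift (r *P p)) i)) (coeff-scale c r i) ⟩
        d ℤ.* coeff p i ℤ.+ (c ℤ.* coeff r i ℤ.+ coeff (shift (r *P p)) i)
          ≡⟨ solve 3 (λ a b v → a :+ (b :+ v) := b :+ (a :+ v)) refl (d ℤ.* coeff p i) (c ℤ.* coeff r i) _ ⟩
        c ℤ.* coeff r i ℤ.+ (d ℤ.* coeff p i ℤ.+ coeff (shift (r *P p)) i)
          ≡⟨ cong₂ ℤ._+_ (coeff-scale c r i) (trans (coeff-+P (map (d ℤ.*_) p) _ i)
                                                  (cong (ℤ._+ coeff (shift (r *P p)) i) (coeff-scale d p i))) ⟨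
        coeff (map (c ℤ.*_) r) i ℤ.+ coeff (map (d ℤ.*_) p +P shift (r *P p)) i
          ≡⟨ coeff-+P (map (c ℤ.*_) r) _ i ⟨
        coeff (map (c ℤ.*_) r +P (map (d ℤ.*_) p +P shift (r *P p))) i ∎
    }
    where open ≡-Reasoning

  *P-comm : ∀ p r → (p *P r) ≋ (r *P p)
  *P-comm []      r = ≋-sym (*P-zeroʳ r)
  *P-comm (c ∷ p) r = ≋-trans (+P-congʳ (map (c ℤ.*_) r) (shift-cong (*P-comm p r))) (≋-sym (*P-∷ʳ r c p))

  scale-*P : ∀ c r s → (map (c ℤ.*_) r *P s) ≋ map (c ℤ.*_) (r *P s)
  scale-*P c []      s = ≋-refl
  scale-*P c (d ∷ r) s = mk≋ λ i →
    trans (coeff-∷*P (c ℤ.* d) (map (c ℤ.*_) r) s i)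
          (trans (rearrange i) (sym (trans (coeff-scale c ((d ∷ r) *P s) i) (cong (c ℤ.*_) (coeff-∷*P d r s i)))))
    where
    rearrange : ∀ i → (c ℤ.* d) ℤ.* coeff s i ℤ.+ coeff (shift (map (c ℤ.*_) r *P s)) i
                    ≡ c ℤ.* (d ℤ.* coeff s i ℤ.+ coeff (shift (r *P s)) i)
    rearrange zero = solve 3 (λ c d x → (c :* d) :* x :+ con (+ 0) := c :* (d :* x :+ con (+ 0))) refl c d (coeff s 0)
    rearrange (suc j) rewrite at (scale-*P c r s) j | coeff-scale c (r *P s) j =
      solve 4 (λ c d x u → (c :* d) :* x :+ c :* u := c :* (d :* x :+ u)) refl c d (coeff s (suc j)) (coeff (r *P s) j)

  shift-*P : ∀ x s → (shift x *P s) ≋ shift (x *P s)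
  shift-*P x s = mk≋ λ i →
    trans (coeff-∷*P (+ 0) x s i) (trans (cong (ℤ._+ coeff (shift (x *P s)) i) (ℤ.*-zeroˡ (coeff s i))) (ℤ.+-identityˡ _))

  *P-shift : ∀ x s → (x *P shift s) ≋ shift (x *P s)
  *P-shift x s = ≋-trans (*P-comm x (shift s)) (≋-trans (shift-*P s x) (shift-cong (*P-comm s x)))

  *P-assoc : ∀ p r s → ((p *P r) *P s) ≋ (p *P (r *P s))
  *P-assoc []      r s = ≋-refl
  *P-assoc (c ∷ p) r s =
    ≋-trans (*P-distribʳ (map (c ℤ.*_) r) (shift (p *P r)) s)
            (+P-cong (scale-*P c r s) (≋-trans (shift-*P (p *P r) s) (shift-cong (*P-assoc p r s))))

  *P-identityˡ : ∀ p → (oneP *P p) ≋ p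
  *P-identityˡ p = mk≋ λ i → trans (coeff-∷*P (+ 1) [] p i) (trans (cong₂ ℤ._+_ (ℤ.*-identityˡ (coeff p i)) (shift-[] i)) (ℤ.+-identityʳ (coeff p i)))
    where
    shift-[] : ∀ i → coeff (shift ([] *P p)) i ≡ + 0
    shift-[] zero    = refl
    shift-[] (suc i) = refl

  *P-identityʳ : ∀ p → (p *P oneP) ≋ p
  *P-identityʳ p = ≋-trans (*P-comm p oneP) (*P-identityˡ p)

  negP-cong : ∀ {x y} → x ≋ y → negP x ≋ negP y
  negP-cong {x} {y} h = mk≋ λ i → trans (coeff-negP x i) (trans (cong ℤ.-_ (at h i)) (sym (coeff-negP y i)))

  negP-*P : ∀ x y → (negP x *P y) ≋ negP (x *P y)
  negP-*P []      y = ≋-refl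
  negP-*P (c ∷ x) y = mk≋ λ i →
    trans (coeff-∷*P (ℤ.- c) (negP x) y i)
          (trans (rearrange i) (sym (trans (coeff-negP ((c ∷ x) *P y) i) (cong ℤ.-_ (coeff-∷*P c x y i)))))
    where
    rearrange : ∀ i → (ℤ.- c) ℤ.* coeff y i ℤ.+ coeff (shift (negP x *P y)) i
                    ≡ ℤ.- (c ℤ.* coeff y i ℤ.+ coeff (shift (x *P y)) i)
    rearrange zero = solve 2 (λ c u → (:- c) :* u :+ con (+ 0) := :- (c :* u :+ con (+ 0))) refl c (coeff y 0)
    rearrange (suc j) rewrite at (negP-*P x y) j | coeff-negP (x *P y) j =
      solve 3 (λ c u v → (:- c) :* u :+ (:- v) := :- (c :* u :+ v)) refl c (coeff y (suc j)) (coeff (x *P y) j)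

  negP-+P : ∀ x y → (negP x +P negP y) ≋ negP (x +P y)
  negP-+P x y = mk≋ λ i →
    trans (coeff-+P (negP x) (negP y) i)
    (trans (cong₂ ℤ._+_ (coeff-negP x i) (coeff-negP y i))
    (trans (sym (ℤ.neg-distrib-+ (coeff x i) (coeff y i)))
    (trans (cong ℤ.-_ (sym (coeff-+P x y i))) (sym (coeff-negP (x +P y) i)))))

  +P-*P-isCommutativeSemiring : IsCommutativeSemiring _≋_ _+P_ _*P_ [] oneP
  +P-*P-isCommutativeSemiring = record
    { isSemiring = record
      { isSemiringWithoutAnnihilatingZero = record
        { +-isCommutativeMonoid = record
          { isMonoid = record
            { isSemigroup = record
              { isMagma = record { isEquivalence = ≋-isEquivalence ; ∙-cong = +P-cong }
              ; assoc = +P-assoc }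
            ; identity = (λ _ → ≋-refl) , +P-identityʳ }
          ; comm = +P-comm }
        ; *-cong = *P-cong
        ; *-assoc = *P-assoc
        ; *-identity = *P-identityˡ , *P-identityʳ
        ; distrib = *P-distribˡ , (λ x y z → *P-distribʳ y z x) }
      ; zero = (λ _ → ≋-refl) , *P-zeroʳ }
    ; *-comm = *P-comm }

  polyAlmostCommutativeRing : AlmostCommutativeRing 0ℓ 0ℓ
  polyAlmostCommutativeRing = record
    { Carrier = Poly ; _≈_ = _≋_ ; _+_ = _+P_ ; _*_ = _*P_ ; -_ = negP ; 0# = [] ; 1# = oneP
    ; isAlmostCommutativeRing = record
      { isCommutativeSemiring = +P-*P-isCommutativeSemiring
      ; -‿cong = negP-cong ; -‿*-distribˡ = negP-*P ; -‿+-comm = negP-+P } }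

  constP-homomorphism : CommutativeRing.rawRing ℤ.+-*-commutativeRing -Raw-AlmostCommutative⟶ polyAlmostCommutativeRing
  constP-homomorphism = record
    { ⟦_⟧ = constP
    ; +-homo = λ _ _ → ≋-refl
    ; *-homo = λ _ _ → mk≋ λ { zero → sym (ℤ.+-identityʳ _) ; (suc i) → refl }
    ; -‿homo = λ _ → ≋-refl
    ; 0-homo = mk≋ λ { zero → refl ; (suc i) → refl }
    ; 1-homo = ≋-refl }

  constP-≟ : (a b : ℤ) → Maybe (constP a ≋ constP b)
  constP-≟ a b with a ℤ.≟ b
  ... | yes refl = just ≋-refl
  ... | no _     = nothing

  module PolySolver = RingSolver _ polyAlmostCommutativeRing constP-homomorphism constP-≟

open PolyArithmetic
open PolySolver using (solve; _:+_; _:*_; _:=_; :-_; con)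
open import Relation.Binary.Reasoning.Setoid ≋-setoid

q : Poly
q = qPow 1

shift≋q*P : ∀ x → shift x ≋ (q *P x)
shift≋q*P x = ≋-sym (≋-trans (shift-*P oneP x) (shift-cong (*P-identityˡ x)))

qPow-suc : ∀ a → qPow (suc a) ≋ (q *P qPow a)
qPow-suc a = shift≋q*P (qPow a)

qPow-+ : ∀ a b → qPow (a ℕ.+ b) ≋ (qPow a *P qPow b)
qPow-+ zero    b = ≋-sym (*P-identityˡ (qPow b))
qPow-+ (suc a) b = ≋-trans (shift-cong (qPow-+ a b)) (≋-sym (shift-*P (qPow a) (qPow b)))

qPow-cancelˡ : ∀ n {x y} → (qPow n *P x) ≋ (qPow n *P y) → x ≋ y
qPow-cancelˡ zero    {x} {y} h = ≋-trans (≋-sym (*P-identityˡ x)) (≋-trans h (*P-identityˡ y))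
qPow-cancelˡ (suc n) {x} {y} h =
  qPow-cancelˡ n (shift-injective (≋-trans (≋-sym (shift-*P (qPow n) x)) (≋-trans h (shift-*P (qPow n) y))))

qInt-suc : ∀ a → qInt (suc a) ≋ (oneP +P (q *P qInt a))
qInt-suc a = +P-congʳ oneP (shift≋q*P (qInt a))

qInt-sucʳ : ∀ a → qInt (suc a) ≋ (qInt a +P qPow a)
qInt-sucʳ zero    = ≋-refl
qInt-sucʳ (suc a) = begin
  qInt (suc (suc a))                     ≈⟨ qInt-suc (suc a) ⟩
  oneP +P (q *P qInt (suc a))            ≈⟨ +P-congʳ oneP (*P-congʳ q (qInt-sucʳ a)) ⟩
  oneP +P (q *P (qInt a +P qPow a))      ≈⟨ solve 3 (λ q x y → con (+ 1) :+ q :* (x :+ y) := (con (+ 1) :+ q :* x) :+ q :* y)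
                                                  ≋-refl q (qInt a) (qPow a) ⟩
  (oneP +P (q *P qInt a)) +P (q *P qPow a) ≈⟨ +P-cong (qInt-suc a) (qPow-suc a) ⟨
  qInt (suc a) +P qPow (suc a)           ∎

-- Oriented paths

transfer : Dir → Poly × Poly → Poly × Poly
transfer right (i , o) = (q *P i , i +P o)
transfer left  (i , o) = (q *P (i +P o) , o)

-- The closures of the path with edges ds, counted by size, that contain (first component)
-- or avoid (second component) its first vertex.
closurePolys : List Dir → Poly × Poly
closurePolys = foldr transfer (q , oneP)

inPoly outPoly closurePoly : List Dir → Poly
inPoly ds      = proj₁ (closurePolys ds)
outPoly ds     = proj₂ (closurePolys ds)
closurePoly ds = inPoly ds +P outPoly ds

-- transfer d acts by the matrix [[q,0],[1,1]] or [[q,q],[0,1]], both of determinant q.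
transfer-det : ∀ d i o i' o' z → (i *P o') ≋ ((i' *P o) +P z)
  → (proj₁ (transfer d (i , o)) *P proj₂ (transfer d (i' , o')))
    ≋ ((proj₁ (transfer d (i' , o')) *P proj₂ (transfer d (i , o))) +P (q *P z))
transfer-det right i o i' o' z h = begin
  (q *P i) *P (i' +P o')                 ≈⟨ solve 4 (λ q i i' o' → (q :* i) :* (i' :+ o') := q :* (i :* o') :+ q :* (i :* i'))
                                              ≋-refl q i i' o' ⟩
  (q *P (i *P o')) +P (q *P (i *P i'))   ≈⟨ +P-congˡ (q *P (i *P i')) (*P-congʳ q h) ⟩
  (q *P ((i' *P o) +P z)) +P (q *P (i *P i'))
    ≈⟨ solve 5 (λ q i o i' z → q :* (i' :* o :+ z) :+ q :* (i :* i') := (q :* i') :* (i :+ o) :+ q :* z)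
         ≋-refl q i o i' z ⟩
  ((q *P i') *P (i +P o)) +P (q *P z)    ∎
transfer-det left i o i' o' z h = begin
  (q *P (i +P o)) *P o'                  ≈⟨ solve 4 (λ q i o o' → (q :* (i :+ o)) :* o' := q :* (i :* o') :+ q :* (o :* o'))
                                              ≋-refl q i o o' ⟩
  (q *P (i *P o')) +P (q *P (o *P o'))   ≈⟨ +P-congˡ (q *P (o *P o')) (*P-congʳ q h) ⟩
  (q *P ((i' *P o) +P z)) +P (q *P (o *P o'))
    ≈⟨ solve 5 (λ q o i' o' z → q :* (i' :* o :+ z) :+ q :* (o :* o') := (q :* (i' :+ o')) :* o :+ q :* z)
         ≋-refl q o i' o' z ⟩
  ((q *P (i' +P o')) *P o) +P (q *P z)   ∎

cofactorPolys : List Dir → Poly × Poly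
cofactorPolys = foldr transfer ([] , oneP)

closurePolys-det : ∀ ds → (inPoly ds *P proj₂ (cofactorPolys ds))
                          ≋ ((proj₁ (cofactorPolys ds) *P outPoly ds) +P qPow (suc (length ds)))
closurePolys-det []       = *P-identityʳ q
closurePolys-det (d ∷ ds) =
  ≋-trans (transfer-det d (inPoly ds) (outPoly ds) (proj₁ (cofactorPolys ds)) (proj₂ (cofactorPolys ds)) _
                        (closurePolys-det ds))
          (+P-congʳ (proj₁ (cofactorPolys (d ∷ ds)) *P outPoly (d ∷ ds)) (≋-sym (qPow-suc (suc (length ds)))))

outPoly-lefts : ∀ c E → outPoly (replicate c left ++ E) ≡ outPoly E
outPoly-lefts zero    E = refl
outPoly-lefts (suc c) E = outPoly-lefts c E

inPoly-lefts : ∀ c E → inPoly (replicate c left ++ E) ≋ ((qPow c *P inPoly E) +P ((q *P qInt c) *P outPoly E))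
inPoly-lefts zero    E = ≋-sym (≋-trans (+P-cong (*P-identityˡ (inPoly E)) (*P-congˡ (outPoly E) (*P-zeroʳ q)))
                                       (+P-identityʳ (inPoly E)))
inPoly-lefts (suc c) E = begin
  q *P (inPoly (replicate c left ++ E) +P outPoly (replicate c left ++ E))
    ≈⟨ *P-congʳ q (+P-cong (inPoly-lefts c E) (mk≋ λ i → cong (λ p → coeff p i) (outPoly-lefts c E))) ⟩
  q *P (((qPow c *P I) +P ((q *P qInt c) *P O)) +P O)
    ≈⟨ solve 5 (λ q x y i o → q :* ((x :* i :+ (q :* y) :* o) :+ o) := (q :* x) :* i :+ (q :* (con (+ 1) :+ q :* y)) :* o)
         ≋-refl q (qPow c) (qInt c) I O ⟩
  ((q *P qPow c) *P I) +P ((q *P (oneP +P (q *P qInt c))) *P O)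
    ≈⟨ +P-cong (*P-congˡ I (qPow-suc c)) (*P-congˡ O (*P-congʳ q (qInt-suc c))) ⟨
  (qPow (suc c) *P I) +P ((q *P qInt (suc c)) *P O) ∎
  where
  I = inPoly E
  O = outPoly E

inPoly-rights : ∀ c E → inPoly (replicate c right ++ E) ≋ (qPow c *P inPoly E)
inPoly-rights zero    E = ≋-sym (*P-identityˡ (inPoly E))
inPoly-rights (suc c) E =
  ≋-trans (*P-congʳ q (inPoly-rights c E))
          (≋-trans (≋-sym (*P-assoc q (qPow c) (inPoly E))) (*P-congˡ (inPoly E) (≋-sym (qPow-suc c))))

outPoly-rights : ∀ c E → outPoly (replicate c right ++ E) ≋ (outPoly E +P (qInt c *P inPoly E))
outPoly-rights zero    E = ≋-sym (+P-identityʳ (outPoly E))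
outPoly-rights (suc c) E = begin
  inPoly (replicate c right ++ E) +P outPoly (replicate c right ++ E)
    ≈⟨ +P-cong (inPoly-rights c E) (outPoly-rights c E) ⟩
  (qPow c *P I) +P (O +P (qInt c *P I))
    ≈⟨ solve 4 (λ x y i o → x :* i :+ (o :+ y :* i) := o :+ (y :+ x) :* i) ≋-refl (qPow c) (qInt c) I O ⟩
  O +P ((qInt c +P qPow c) *P I)
    ≈⟨ +P-congʳ O (*P-congˡ I (qInt-sucʳ c)) ⟨
  O +P (qInt (suc c) *P I) ∎
  where
  I = inPoly E
  O = outPoly E

-- The q-continued fraction

-- ((k , p) , (l , d)) ≃[ t ] (P , D) says q^(-k) p = q^(-t) P and q^(-l) d = q^(-t) D.
infix 4 _≃[_]_
_≃[_]_ : Laurent × Laurent → ℕ → Poly × Poly → Set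
((k , p) , (l , d)) ≃[ t ] (P , D) = ((qPow t *P p) ≋ (qPow k *P P)) × ((qPow t *P d) ≋ (qPow l *P D))

stepCF : Bool → ℕ → Laurent × Laurent → Laurent × Laurent
stepCF b a (N , D) = ((termL b a *L N) +L (numerL b a *L D) , N)

cfqFrom-∷ : ∀ b a c as → cfqFrom b (a ∷ c ∷ as) ≡ stepCF b a (cfqFrom (not b) (c ∷ as))
cfqFrom-∷ b a c as with cfqFrom (not b) (c ∷ as)
... | (N , D) = refl

cfPolys : Bool → List ℕ → Poly × Poly
cfPolys true  as = (inPoly D , q *P outPoly D)   where D = blocks left (decLast as)
cfPolys false as = (q *P outPoly D , inPoly D)   where D = blocks right (decLast as)

stepCF-true : ∀ a E ND t → ND ≃[ t ] (q *P outPoly E , inPoly E)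
  → stepCF true a ND ≃[ t ] (inPoly (replicate a left ++ E) , q *P outPoly (replicate a left ++ E))
stepCF-true a E ((k , p) , (l , d)) t (hp , hd) rewrite outPoly-lefts a E = (begin
  qPow t *P ((qPow l *P (qInt a *P p)) +P (qPow k *P (qPow a *P d)))
    ≈⟨ solve 7 (λ T L K A P X D → T :* ((L :* (A :* P)) :+ (K :* (X :* D))) := L :* A :* (T :* P) :+ K :* X :* (T :* D))
         ≋-refl (qPow t) (qPow l) (qPow k) (qInt a) p (qPow a) d ⟩
  (qPow l *P qInt a *P (qPow t *P p)) +P (qPow k *P qPow a *P (qPow t *P d))
    ≈⟨ +P-cong (*P-congʳ (qPow l *P qInt a) hp) (*P-congʳ (qPow k *P qPow a) hd) ⟩
  (qPow l *P qInt a *P (qPow k *P (q *P O))) +P (qPow k *P qPow a *P (qPow l *P I))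
    ≈⟨ solve 7 (λ L A K q O X I → (L :* A :* (K :* (q :* O))) :+ (K :* X :* (L :* I)) := (K :* L) :* ((X :* I) :+ ((q :* A) :* O)))
         ≋-refl (qPow l) (qInt a) (qPow k) q O (qPow a) I ⟩
  (qPow k *P qPow l) *P ((qPow a *P I) +P ((q *P qInt a) *P O))
    ≈⟨ *P-cong (qPow-+ k l) (inPoly-lefts a E) ⟨
  qPow (k ℕ.+ l) *P inPoly (replicate a left ++ E) ∎) , hp
  where
  I = inPoly E
  O = outPoly E

stepCF-false : ∀ a' F ND t → ND ≃[ t ] (inPoly F , q *P outPoly F)
  → stepCF false (suc a') ND
      ≃[ t ℕ.+ suc a' ] (q *P outPoly (replicate (suc a') right ++ F) , inPoly (replicate (suc a') right ++ F))
stepCF-false a' F ((k , p) , (l , d)) t (hp , hd) = (begin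
  qPow (t ℕ.+ a) *P ((qPow (a ℕ.+ l) *P (qInt a *P p)) +P (qPow (a' ℕ.+ k) *P (oneP *P d)))
    ≈⟨ *P-cong (≋-trans (qPow-+ t a) (*P-congʳ (qPow t) (qPow-suc a')))
               (+P-cong (*P-congˡ _ (≋-trans (qPow-+ a l) (*P-congˡ L (qPow-suc a')))) (*P-congˡ _ (qPow-+ a' k))) ⟩
  (qPow t *P (q *P X)) *P ((((q *P X) *P L) *P (qInt a *P p)) +P ((X *P K) *P (oneP *P d)))
    ≈⟨ solve 8 (λ T q X L A P K D → (T :* (q :* X)) :* ((((q :* X) :* L) :* (A :* P)) :+ ((X :* K) :* (con (+ 1) :* D)))
                := (q :* X :* q :* X :* L :* A) :* (T :* P) :+ (q :* X :* X :* K) :* (T :* D))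
         ≋-refl (qPow t) q X L (qInt a) p K d ⟩
  ((q *P X *P q *P X *P L *P qInt a) *P (qPow t *P p)) +P ((q *P X *P X *P K) *P (qPow t *P d))
    ≈⟨ +P-cong (*P-congʳ (q *P X *P q *P X *P L *P qInt a) hp) (*P-congʳ (q *P X *P X *P K) hd) ⟩
  ((q *P X *P q *P X *P L *P qInt a) *P (K *P I)) +P ((q *P X *P X *P K) *P (L *P (q *P O)))
    ≈⟨ solve 7 (λ q X L A K I O → ((q :* X :* q :* X :* L :* A) :* (K :* I)) :+ ((q :* X :* X :* K) :* (L :* (q :* O)))
                := ((X :* K) :* ((q :* X) :* L)) :* (q :* (O :+ A :* I)))
         ≋-refl q X L (qInt a) K I O ⟩
  ((X *P K) *P ((q *P X) *P L)) *P (q *P (O +P (qInt a *P I)))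
    ≈⟨ *P-cong (≋-trans (qPow-+ (a' ℕ.+ k) (a ℕ.+ l))
                        (*P-cong (qPow-+ a' k) (≋-trans (qPow-+ a l) (*P-congˡ L (qPow-suc a')))))
               (*P-congʳ q (outPoly-rights a F)) ⟨
  qPow ((a' ℕ.+ k) ℕ.+ (a ℕ.+ l)) *P (q *P outPoly (replicate a right ++ F)) ∎)
  , (begin
  qPow (t ℕ.+ a) *P p        ≈⟨ *P-congˡ p (qPow-+ t a) ⟩
  (qPow t *P qPow a) *P p    ≈⟨ solve 3 (λ T X P → (T :* X) :* P := X :* (T :* P)) ≋-refl (qPow t) (qPow a) p ⟩
  qPow a *P (qPow t *P p)    ≈⟨ *P-congʳ (qPow a) hp ⟩
  qPow a *P (K *P I)         ≈⟨ solve 3 (λ X K I → X :* (K :* I) := K :* (X :* I)) ≋-refl (qPow a) K I ⟩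
  K *P (qPow a *P I)         ≈⟨ *P-congʳ K (inPoly-rights a F) ⟨
  K *P inPoly (replicate a right ++ F) ∎)
  where
  a = suc a'
  X = qPow a'
  K = qPow k
  L = qPow l
  I = inPoly F
  O = outPoly F

cfqFrom-≃ : ∀ b a as → All (1 ≤_) (a ∷ as) → Σ ℕ λ t → cfqFrom b (a ∷ as) ≃[ t ] cfPolys b (a ∷ as)
cfqFrom-≃ b zero _ (() ∷ _)
cfqFrom-≃ true (suc a') [] _ = 1 , (begin
  q *P qInt (suc a')                         ≈⟨ *P-congʳ q (qInt-sucʳ a') ⟩
  q *P (qInt a' +P qPow a')                  ≈⟨ solve 3 (λ q y x → q :* (y :+ x) := con (+ 1) :* (x :* q :+ (q :* y) :* con (+ 1)))
                                                    ≋-refl q (qInt a') (qPow a') ⟩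
  oneP *P ((qPow a' *P q) +P ((q *P qInt a') *P oneP))
                                             ≈⟨ *P-congʳ oneP (inPoly-lefts a' []) ⟨
  oneP *P inPoly (replicate a' left ++ [])   ∎)
  , subst (λ o → (q *P oneP) ≋ (oneP *P (q *P o))) (sym (outPoly-lefts a' [])) (≋-sym (*P-identityˡ _))
cfqFrom-≃ false (suc a') [] _ = suc a' , (begin
  qPow (suc a') *P qInt (suc a')             ≈⟨ *P-cong (qPow-suc a') (qInt-suc a') ⟩
  (q *P qPow a') *P (oneP +P (q *P qInt a')) ≈⟨ solve 3 (λ q x y → (q :* x) :* (con (+ 1) :+ q :* y) := x :* (q :* (con (+ 1) :+ y :* q)))
                                                    ≋-refl q (qPow a') (qInt a') ⟩
  qPow a' *P (q *P (oneP +P (qInt a' *P q))) ≈⟨ *P-congʳ (qPow a') (*P-congʳ q (outPoly-rights a' [])) ⟨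
  qPow a' *P (q *P outPoly (replicate a' right ++ [])) ∎)
  , (begin
  qPow (suc a') *P oneP                      ≈⟨ *P-identityʳ _ ⟩
  qPow (suc a')                              ≈⟨ ≋-trans (qPow-suc a') (*P-comm q (qPow a')) ⟩
  qPow a' *P q                               ≈⟨ *P-identityˡ _ ⟨
  oneP *P (qPow a' *P q)                     ≈⟨ *P-congʳ oneP (inPoly-rights a' []) ⟨
  oneP *P inPoly (replicate a' right ++ [])  ∎)
cfqFrom-≃ true a (c ∷ as) (_ ∷ ps) rewrite cfqFrom-∷ true a c as with cfqFrom-≃ false c as ps
... | t , h = t , stepCF-true a (blocks right (decLast (c ∷ as))) (cfqFrom false (c ∷ as)) t h
cfqFrom-≃ false (suc a') (c ∷ as) (_ ∷ ps) rewrite cfqFrom-∷ false (suc a') c as with cfqFrom-≃ true c as ps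
... | t , h = t ℕ.+ suc a' , stepCF-false a' (blocks left (decLast (c ∷ as))) (cfqFrom true (c ∷ as)) t h

-- Coprime fractions

sameFrac-cross : ∀ R S ND t P D → SameFrac R S ND → ND ≃[ t ] (P , D) → (R *P D) ≋ (S *P P)
sameFrac-cross R S ((k , p) , (l , d)) t P D sf (hp , hd) = qPow-cancelˡ (k ℕ.+ l) (begin
  qPow (k ℕ.+ l) *P (R *P D)    ≈⟨ *P-congˡ (R *P D) (qPow-+ k l) ⟩
  (K *P L) *P (R *P D)          ≈⟨ solve 4 (λ K L R D → (K :* L) :* (R :* D) := K :* (R :* (L :* D))) ≋-refl K L R D ⟩
  K *P (R *P (L *P D))          ≈⟨ *P-congʳ K (*P-congʳ R hd) ⟨
  K *P (R *P (T *P d))          ≈⟨ solve 4 (λ K R T d → K :* (R :* (T :* d)) := T :* (K :* (R :* d))) ≋-refl K R T d ⟩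
  T *P (K *P (R *P d))          ≈⟨ *P-congʳ T (mk≋ sf) ⟩
  T *P (L *P (S *P p))          ≈⟨ solve 4 (λ T L S p → T :* (L :* (S :* p)) := L :* (S :* (T :* p))) ≋-refl T L S p ⟩
  L *P (S *P (T *P p))          ≈⟨ *P-congʳ L (*P-congʳ S hp) ⟩
  L *P (S *P (K *P P))          ≈⟨ solve 4 (λ L S K P → L :* (S :* (K :* P)) := (K :* L) :* (S :* P)) ≋-refl L S K P ⟩
  (K *P L) *P (S *P P)          ≈⟨ *P-congˡ (S *P P) (qPow-+ k l) ⟨
  qPow (k ℕ.+ l) *P (S *P P)    ∎)
  where
  K = qPow k
  L = qPow l
  T = qPow t

-- Z stands for the determinant I O' - I' O.
cross-bezout : ∀ I O I' O' Z R S → (R *P O) ≋ (S *P (I +P O)) → (I *P O') ≋ ((I' *P O) +P Z)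
  → Σ Poly λ W → ((Z *P R) ≋ ((I +P O) *P W)) × ((Z *P S) ≋ (O *P W))
cross-bezout I O I' O' Z R S cross det = W , ZR≋TW , ZS≋OW
  where
  W = ((R +P negP S) *P O') +P negP (I' *P S)
  ZS≋OW : (Z *P S) ≋ (O *P W)
  ZS≋OW = ≋-sym (begin
    O *P W
      ≈⟨ solve 6 (λ O I' O' R S Z → O :* (((R :+ :- S) :* O') :+ :- (I' :* S))
                    := (R :* O) :* O' :+ :- (S :* O :* O') :+ :- (O :* I' :* S)) ≋-refl O I' O' R S Z ⟩
    ((R *P O) *P O') +P negP (S *P O *P O') +P negP (O *P I' *P S)
      ≈⟨ +P-congˡ (negP (O *P I' *P S)) (+P-congˡ (negP (S *P O *P O')) (*P-congˡ O' cross)) ⟩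
    ((S *P (I +P O)) *P O') +P negP (S *P O *P O') +P negP (O *P I' *P S)
      ≈⟨ solve 5 (λ I O I' O' S → ((S :* (I :+ O)) :* O') :+ :- (S :* O :* O') :+ :- (O :* I' :* S)
                    := S :* (I :* O') :+ :- (S :* (I' :* O))) ≋-refl I O I' O' S ⟩
    (S *P (I *P O')) +P negP (S *P (I' *P O))
      ≈⟨ +P-congˡ (negP (S *P (I' *P O))) (*P-congʳ S det) ⟩
    (S *P ((I' *P O) +P Z)) +P negP (S *P (I' *P O))
      ≈⟨ solve 4 (λ O I' S Z → (S :* ((I' :* O) :+ Z)) :+ :- (S :* (I' :* O)) := Z :* S) ≋-refl O I' S Z ⟩
    Z *P S ∎)
  IW≋Z[R-S] : (I *P W) ≋ (Z *P (R +P negP S))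
  IW≋Z[R-S] = begin
    I *P W
      ≈⟨ solve 6 (λ I I' O' R S Z → I :* (((R :+ :- S) :* O') :+ :- (I' :* S))
                    := (I :* O') :* (R :+ :- S) :+ :- (I' :* (S :* I))) ≋-refl I I' O' R S Z ⟩
    ((I *P O') *P (R +P negP S)) +P negP (I' *P (S *P I))
      ≈⟨ +P-congˡ (negP (I' *P (S *P I))) (*P-congˡ (R +P negP S) det) ⟩
    (((I' *P O) +P Z) *P (R +P negP S)) +P negP (I' *P (S *P I))
      ≈⟨ solve 6 (λ I O I' R S Z → (((I' :* O) :+ Z) :* (R :+ :- S)) :+ :- (I' :* (S :* I))
                    := Z :* (R :+ :- S) :+ I' :* (R :* O) :+ :- (I' :* (S :* (I :+ O)))) ≋-refl I O I' R S Z ⟩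
    (Z *P (R +P negP S)) +P (I' *P (R *P O)) +P negP (I' *P (S *P (I +P O)))
      ≈⟨ +P-congˡ (negP (I' *P (S *P (I +P O)))) (+P-congʳ (Z *P (R +P negP S)) (*P-congʳ I' cross)) ⟩
    (Z *P (R +P negP S)) +P (I' *P (S *P (I +P O))) +P negP (I' *P (S *P (I +P O)))
      ≈⟨ solve 2 (λ x y → x :+ y :+ :- y := x) ≋-refl (Z *P (R +P negP S)) (I' *P (S *P (I +P O))) ⟩
    Z *P (R +P negP S) ∎
  ZR≋TW : (Z *P R) ≋ ((I +P O) *P W)
  ZR≋TW = begin
    Z *P R                            ≈⟨ solve 3 (λ Z R S → Z :* R := Z :* (R :+ :- S) :+ Z :* S) ≋-refl Z R S ⟩
    (Z *P (R +P negP S)) +P (Z *P S)  ≈⟨ +P-cong (≋-sym IW≋Z[R-S]) ZS≋OW ⟩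
    (I *P W) +P (O *P W)              ≈⟨ *P-distribʳ I O W ⟨
    (I +P O) *P W                     ∎

coeff₀-*P : ∀ p r → coeff (p *P r) 0 ≡ coeff p 0 ℤ.* coeff r 0
coeff₀-*P []      r = sym (ℤ.*-zeroˡ (coeff r 0))
coeff₀-*P (c ∷ p) r = trans (coeff-∷*P c p r 0) (ℤ.+-identityʳ _)

shift-drop₁ : ∀ V → coeff V 0 ≡ + 0 → V ≋ shift (drop 1 V)
shift-drop₁ []      _  = mk≋ λ { zero → refl ; (suc i) → refl }
shift-drop₁ (c ∷ v) c₀ = mk≋ λ { zero → c₀ ; (suc i) → refl }

qPow-cancel-common : ∀ j R S T O W → coeff T 0 ≡ + 1 → (qPow j *P R) ≋ (T *P W) → (qPow j *P S) ≋ (O *P W)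
  → Σ Poly λ W' → (R ≋ (T *P W')) × (S ≋ (O *P W'))
qPow-cancel-common zero    R S T O W _  hR hS = W , ≋-trans (≋-sym (*P-identityˡ R)) hR , ≋-trans (≋-sym (*P-identityˡ S)) hS
qPow-cancel-common (suc j) R S T O W T₀ hR hS = qPow-cancel-common j R S T O (drop 1 W) T₀ (unshift R T hR) (unshift S O hS)
  where
  W₀ : coeff W 0 ≡ + 0
  W₀ = trans (sym (ℤ.*-identityˡ (coeff W 0)))
       (trans (cong (ℤ._* coeff W 0) (sym T₀))
       (trans (sym (coeff₀-*P T W))
       (trans (sym (at hR 0)) (at (shift-*P (qPow j) R) 0))))
  unshift : ∀ X Y → (qPow (suc j) *P X) ≋ (Y *P W) → (qPow j *P X) ≋ (Y *P drop 1 W)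
  unshift X Y h = shift-injective
    (≋-trans (≋-sym (shift-*P (qPow j) X)) (≋-trans h (≋-trans (*P-congʳ Y (shift-drop₁ W W₀)) (*P-shift Y (drop 1 W)))))

zero-or-degree : ∀ p → p ≋ [] ⊎ Σ ℕ λ a → (coeff p a ≢ + 0) × (∀ j → a < j → coeff p j ≡ + 0)
zero-or-degree []      = inj₁ ≋-refl
zero-or-degree (c ∷ p) with zero-or-degree p
... | inj₂ (a , lead , above) = inj₂ (suc a , lead , λ { (suc j) (s≤s a<j) → above j a<j })
... | inj₁ p≋0 with c ℤ.≟ + 0
...   | yes c≡0 = inj₁ (mk≋ λ { zero → c≡0 ; (suc j) → at p≋0 j })
...   | no  c≢0 = inj₂ (0 , c≢0 , λ { (suc j) _ → at p≋0 j })

coeff-*P-top : ∀ p r a b → (∀ j → a < j → coeff p j ≡ + 0) → (∀ j → b < j → coeff r j ≡ + 0)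
  → coeff (p *P r) (a ℕ.+ b) ≡ coeff p a ℤ.* coeff r b
coeff-*P-top []      r a       b _     _     = sym (ℤ.*-zeroˡ (coeff r b))
coeff-*P-top (c ∷ p) r zero    b above _     =
  trans (coeff-∷*P c p r b) (trans (cong (λ x → c ℤ.* coeff r b ℤ.+ x) (tail-zero b)) (ℤ.+-identityʳ _))
  where
  tail-zero : ∀ b → coeff (shift (p *P r)) b ≡ + 0
  tail-zero zero     = refl
  tail-zero (suc b') = at (*P-zeroˡ {p} r (mk≋ λ j → above (suc j) (s≤s z≤n))) b'
coeff-*P-top (c ∷ p) r (suc a) b above aboveʳ =
  trans (coeff-∷*P c p r (suc a ℕ.+ b))
  (trans (cong (λ x → c ℤ.* x ℤ.+ coeff (p *P r) (a ℕ.+ b)) (aboveʳ (suc (a ℕ.+ b)) (s≤s (ℕ.m≤n+m b a))))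
  (trans (cong (ℤ._+ coeff (p *P r) (a ℕ.+ b)) (ℤ.*-zeroʳ c))
  (trans (ℤ.+-identityˡ _)
         (coeff-*P-top p r a b (λ j a<j → above (suc j) (s≤s a<j)) aboveʳ))))

*P≋oneP⇒degree-zero : ∀ W U → (W *P U) ≋ oneP → ∀ i → coeff W (suc i) ≡ + 0
*P≋oneP⇒degree-zero W U h i with zero-or-degree W | zero-or-degree U
... | inj₁ W≋0 | _ = at W≋0 (suc i)
... | inj₂ _   | inj₁ U≋0 = ⊥-elim (1≢0 (trans (sym (at h 0)) (at (≋-trans (*P-congʳ W U≋0) (*P-zeroʳ W)) 0)))
  where
  1≢0 : + 1 ≢ + 0
  1≢0 ()
... | inj₂ (zero  , _    , aboveW) | inj₂ _ = aboveW (suc i) (s≤s z≤n)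
... | inj₂ (suc a , leadW , aboveW) | inj₂ (b , leadU , aboveU)
  with ℤ.i*j≡0⇒i≡0∨j≡0 (coeff W (suc a))
         (trans (sym (coeff-*P-top W U (suc a) b aboveW aboveU)) (at h (suc (a ℕ.+ b))))
...   | inj₁ lead≡0 = ⊥-elim (leadW lead≡0)
...   | inj₂ lead≡0 = ⊥-elim (leadU lead≡0)

*P≋oneP⇒±1 : ∀ W U → (W *P U) ≋ oneP → Σ ℤ λ c → (c ≡ + 1 ⊎ c ≡ -[1+ 0 ]) × W ≋ constP c
*P≋oneP⇒±1 W U h = coeff W 0 , ±1 (coeff W 0) (coeff U 0) (trans (sym (coeff₀-*P W U)) (at h 0))
                 , mk≋ λ { zero → refl ; (suc i) → *P≋oneP⇒degree-zero W U h i }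
  where
  ±1 : ∀ c d → c ℤ.* d ≡ + 1 → c ≡ + 1 ⊎ c ≡ -[1+ 0 ]
  ±1 c d cd≡1 with ℕ.m*n≡1⇒m≡1 ℤ.∣ c ∣ ℤ.∣ d ∣ (trans (sym (ℤ.abs-* c d)) (cong ℤ.∣_∣ cd≡1))
  ±1 (+ .1)     d _ | refl = inj₁ refl
  ±1 -[1+ .0 ] d _ | refl = inj₂ refl

eval1-≋[] : ∀ p → p ≋ [] → eval1 p ≡ + 0
eval1-≋[] []      _ = refl
eval1-≋[] (c ∷ p) h = cong₂ ℤ._+_ (at h 0) (eval1-≋[] p (mk≋ λ i → at h (suc i)))

eval1-cong : ∀ p r → p ≋ r → eval1 p ≡ eval1 r
eval1-cong []      r       h = sym (eval1-≋[] r (≋-sym h))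
eval1-cong (c ∷ p) []      h = eval1-≋[] (c ∷ p) h
eval1-cong (c ∷ p) (d ∷ r) h = cong₂ ℤ._+_ (at h 0) (eval1-cong p r (mk≋ λ i → at h (suc i)))

eval1-negP : ∀ p → eval1 (negP p) ≡ ℤ.- eval1 p
eval1-negP []      = refl
eval1-negP (c ∷ p) = trans (cong (λ x → ℤ.- c ℤ.+ x) (eval1-negP p)) (sym (ℤ.neg-distrib-+ c (eval1 p)))

Natural : Poly → Set
Natural p = ∀ i → Σ ℕ λ n → coeff p i ≡ + n

eval1-natural : ∀ p → Natural p → Σ ℕ λ n → eval1 p ≡ + n
eval1-natural []      _   = 0 , refl
eval1-natural (c ∷ p) nat with nat 0 | eval1-natural p (λ i → nat (suc i))
... | m , refl | n , e = m ℕ.+ n , cong (λ x → + m ℤ.+ x) e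

eval1-positive : ∀ p → coeff p 0 ≡ + 1 → Natural p → Σ ℕ λ n → eval1 p ≡ + suc n
eval1-positive (.(+ 1) ∷ p) refl nat with eval1-natural p (λ i → nat (suc i))
... | n , e = n , cong (λ x → + 1 ℤ.+ x) e

coprime-cross-unique : ∀ I O I' O' R S j r → (I *P O') ≋ ((I' *P O) +P qPow j)
  → coeff (I +P O) 0 ≡ + 1 → Natural (I +P O)
  → (R *P O) ≋ (S *P (I +P O)) → CoprimeP R S → eval1 R ≡ + r
  → (R ≋ (I +P O)) × (S ≋ O)
coprime-cross-unique I O I' O' R S j r det T₀ nat cross coprime R₁ = by-sign (*P≋oneP⇒±1 W' U W'U≋1)
  where
  T = I +P O
  common : Σ Poly λ W → ((qPow j *P R) ≋ (T *P W)) × ((qPow j *P S) ≋ (O *P W))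
  common = cross-bezout I O I' O' (qPow j) R S cross det
  reduced : Σ Poly λ W' → (R ≋ (T *P W')) × (S ≋ (O *P W'))
  reduced = qPow-cancel-common j R S T O (proj₁ common) T₀ (proj₁ (proj₂ common)) (proj₂ (proj₂ common))
  W' : Poly
  W' = proj₁ reduced
  R≋TW' : R ≋ (T *P W')
  R≋TW' = proj₁ (proj₂ reduced)
  S≋OW' : S ≋ (O *P W')
  S≋OW' = proj₂ (proj₂ reduced)
  unit : IsUnit W'
  unit = coprime W' T O (at (≋-trans R≋TW' (*P-comm T W'))) (at (≋-trans S≋OW' (*P-comm O W')))
  U : Poly
  U = proj₁ unit
  W'U≋1 : (W' *P U) ≋ oneP
  W'U≋1 = mk≋ (proj₂ unit)
  by-sign : (Σ ℤ λ c → (c ≡ + 1 ⊎ c ≡ -[1+ 0 ]) × W' ≋ constP c) → (R ≋ T) × (S ≋ O)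
  by-sign (_ , inj₁ refl , W'≋1) = ≋-trans R≋TW' (≋-trans (*P-congʳ T W'≋1) (*P-identityʳ T))
                                 , ≋-trans S≋OW' (≋-trans (*P-congʳ O W'≋1) (*P-identityʳ O))
  by-sign (_ , inj₂ refl , W'≋-1) = ⊥-elim (+≢-[1+] (trans (sym R₁) (trans (eval1-cong R (negP T) R≋-T) (trans (eval1-negP T) (cong (λ x → ℤ.- x) (proj₂ T₁))))))
    where
    T₁ : Σ ℕ λ n → eval1 T ≡ + suc n
    T₁ = eval1-positive T T₀ nat
    R≋-T : R ≋ negP T
    R≋-T = ≋-trans R≋TW' (≋-trans (*P-congʳ T W'≋-1) (solve 1 (λ t → t :* con -[1+ 0 ] := :- t) ≋-refl T))
    +≢-[1+] : ∀ {m n} → + m ≢ -[1+ n ]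
    +≢-[1+] ()

-- Counting closures

module _ {A : Set} {P : A → Set} (P? : Decidable P) where

  count : List A → ℕ
  count xs = length (filter P? xs)

  count-++ : ∀ xs ys → count (xs ++ ys) ≡ count xs ℕ.+ count ys
  count-++ xs ys = trans (cong length (List.filter-++ P? xs ys)) (List.length-++ (filter P? xs))

  count-none : (∀ x → ¬ P x) → ∀ xs → count xs ≡ 0
  count-none ¬P xs = cong length (List.filter-none P? (All.universal ¬P xs))

  count-[-]-yes : ∀ {x} → P x → count (x ∷ []) ≡ 1
  count-[-]-yes Px = cong length (List.filter-accept P? {xs = []} Px)

  count-[-]-no : ∀ {x} → ¬ P x → count (x ∷ []) ≡ 0
  count-[-]-no ¬Px = cong length (List.filter-reject P? {xs = []} ¬Px)

count-map : ∀ {A B : Set} {P : B → Set} (P? : Decidable P) (f : A → B) xs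
  → count P? (map f xs) ≡ count (λ x → P? (f x)) xs
count-map P? f []       = refl
count-map P? f (x ∷ xs) with does (P? (f x))
... | true  = cong suc (count-map P? f xs)
... | false = count-map P? f xs

count-≐ : ∀ {A : Set} {P Q : A → Set} (P? : Decidable P) (Q? : Decidable Q) → P ≐ Q → ∀ xs → count P? xs ≡ count Q? xs
count-≐ P? Q? P≐Q xs = cong length (List.filter-≐ P? Q? P≐Q xs)

count-allSubsets-suc : ∀ {A : Set} {P : A → Set} (P? : Decidable P) k (g : Subset (suc k) → A)
  → count (λ C → P? (g C)) (allSubsets (suc k))
    ≡ count (λ C → P? (g (true ∷ C))) (allSubsets k) ℕ.+ count (λ C → P? (g (false ∷ C))) (allSubsets k)
count-allSubsets-suc P? k g =
  trans (count-++ (λ C → P? (g C)) (map (true ∷_) (allSubsets k)) (map (false ∷_) (allSubsets k)))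
        (cong₂ ℕ._+_ (count-map (λ C → P? (g C)) (true ∷_) (allSubsets k))
                     (count-map (λ C → P? (g C)) (false ∷_) (allSubsets k)))

Edge-suc : ∀ {k} d ds {u v : Fin (suc k)} → Edge ds u v → Edge (d ∷ ds) (suc u) (suc v)
Edge-suc d ds (inj₁ (e , r)) = inj₁ (cong suc e , r)
Edge-suc d ds (inj₂ (e , r)) = inj₂ (cong suc e , r)

Edge-suc⁻ : ∀ {k} d ds {u v : Fin (suc k)} → Edge (d ∷ ds) (suc u) (suc v) → Edge ds u v
Edge-suc⁻ d ds (inj₁ (e , r)) = inj₁ (ℕ.suc-injective e , r)
Edge-suc⁻ d ds (inj₂ (e , r)) = inj₂ (ℕ.suc-injective e , r)

toℕ≡0⇒≡zero : ∀ {k} (v : Fin (suc k)) → toℕ v ≡ 0 → v ≡ zero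
toℕ≡0⇒≡zero zero _ = refl

Edge-zero-suc : ∀ {k} d ds (v : Fin (suc k)) → Edge (d ∷ ds) zero (suc v) → v ≡ zero × d ≡ right
Edge-zero-suc d ds v (inj₁ (e , refl)) = toℕ≡0⇒≡zero v (ℕ.suc-injective e) , refl
Edge-zero-suc d ds v (inj₂ (() , _))

Edge-suc-zero : ∀ {k} d ds (u : Fin (suc k)) → Edge (d ∷ ds) (suc u) zero → u ≡ zero × d ≡ left
Edge-suc-zero d ds u (inj₁ (() , _))
Edge-suc-zero d ds u (inj₂ (e , refl)) = toℕ≡0⇒≡zero u (ℕ.suc-injective e) , refl

¬Edge-zero-zero : ∀ {k} ds → ¬ Edge {suc k} ds zero zero
¬Edge-zero-zero ds (inj₁ (() , _))
¬Edge-zero-zero ds (inj₂ (() , _))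

-- The membership flags x, y of the endpoints of an edge of direction d that a closure allows.
Compatible : Dir → Bool → Bool → Set
Compatible right x y = x ≡ true → y ≡ true
Compatible left  x y = y ≡ true → x ≡ true

∈-head : ∀ {n} {x : Bool} {C : Subset n} → zero ∈ (x ∷ C) → x ≡ true
∈-head here = refl

∈-tail : ∀ {n} {x : Bool} {C : Subset n} {u} → suc u ∈ (x ∷ C) → u ∈ C
∈-tail (there m) = m

IsClosure-∷⁻ : ∀ {n} d ds x y (C : Subset n) → IsClosure (d ∷ ds) (x ∷ y ∷ C)
  → IsClosure ds (y ∷ C) × Compatible d x y
IsClosure-∷⁻ d ds x y C cl = (λ u v e m → ∈-tail (cl (suc u) (suc v) (Edge-suc d ds e) (there m))) , compatible d refl
  where
  compatible : ∀ d' → d' ≡ d → Compatible d' x y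
  compatible right refl refl = ∈-head (∈-tail (cl zero (suc zero) (inj₁ (refl , refl)) here))
  compatible left  refl refl = ∈-head (cl (suc zero) zero (inj₂ (refl , refl)) (there here))

IsClosure-∷⁺ : ∀ {n} d ds x y (C : Subset n) → IsClosure ds (y ∷ C) → Compatible d x y
  → IsClosure (d ∷ ds) (x ∷ y ∷ C)
IsClosure-∷⁺ {n} d ds x y C cl c zero    zero    e m = ⊥-elim (¬Edge-zero-zero {suc n} (d ∷ ds) e)
IsClosure-∷⁺     d ds x y C cl c zero    (suc v) e m with Edge-zero-suc d ds v e | ∈-head m
... | refl , refl | refl with c refl
... | refl = there here
IsClosure-∷⁺     d ds x y C cl c (suc u) zero    e m with Edge-suc-zero d ds u e
... | refl , refl with ∈-head (∈-tail m)
... | refl with c refl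
... | refl = here
IsClosure-∷⁺     d ds x y C cl c (suc u) (suc v) e m = there (cl u v (Edge-suc⁻ d ds e) (∈-tail m))

IsClosure-[-] : ∀ x → IsClosure [] (x ∷ [])
IsClosure-[-] x zero zero e _ = ⊥-elim (¬Edge-zero-zero {0} [] e)

SizedClosure? : ∀ k ds i → Decidable (λ (C : Subset k) → ∣ C ∣ ≡ i × IsClosure ds C)
SizedClosure? k ds i C = (∣ C ∣ ℕ.≟ i) ×-dec isClosure? ds C

headedClosures : List Dir → Bool → ℕ → ℕ
headedClosures ds x i = count (λ C → SizedClosure? (suc (length ds)) ds i (x ∷ C)) (allSubsets (length ds))

numClosures-split : ∀ ds i → numClosures (suc (length ds)) ds i ≡ headedClosures ds true i ℕ.+ headedClosures ds false i
numClosures-split ds i = count-allSubsets-suc (SizedClosure? (suc (length ds)) ds i) (length ds) (λ C → C)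

module _ (d : Dir) (ds : List Dir) where
  private
    k : ℕ
    k = suc (suc (length ds))
    B : List (Subset (length ds))
    B = allSubsets (length ds)

  headedClosures-split : ∀ x i → headedClosures (d ∷ ds) x i
    ≡ count (λ C → SizedClosure? k (d ∷ ds) i (x ∷ true ∷ C)) B ℕ.+ count (λ C → SizedClosure? k (d ∷ ds) i (x ∷ false ∷ C)) B
  headedClosures-split x i = count-allSubsets-suc (SizedClosure? k (d ∷ ds) i) (length ds) (x ∷_)

  count-in-in : ∀ y i → Compatible d true y
    → count (λ C → SizedClosure? k (d ∷ ds) (suc i) (true ∷ y ∷ C)) B ≡ headedClosures ds y i
  count-in-in y i c = count-≐ (λ C → SizedClosure? k (d ∷ ds) (suc i) (true ∷ y ∷ C)) (λ C → SizedClosure? (suc (length ds)) ds i (y ∷ C))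
    ((λ (size , cl) → ℕ.suc-injective size , proj₁ (IsClosure-∷⁻ d ds true y _ cl))
    , (λ (size , cl) → cong suc size , IsClosure-∷⁺ d ds true y _ cl c)) B

  count-out : ∀ y i → Compatible d false y
    → count (λ C → SizedClosure? k (d ∷ ds) i (false ∷ y ∷ C)) B ≡ headedClosures ds y i
  count-out y i c = count-≐ (λ C → SizedClosure? k (d ∷ ds) i (false ∷ y ∷ C)) (λ C → SizedClosure? (suc (length ds)) ds i (y ∷ C))
    ((λ (size , cl) → size , proj₁ (IsClosure-∷⁻ d ds false y _ cl))
    , (λ (size , cl) → size , IsClosure-∷⁺ d ds false y _ cl c)) B

  count-incompatible : ∀ x y i → ¬ Compatible d x y
    → count (λ C → SizedClosure? k (d ∷ ds) i (x ∷ y ∷ C)) B ≡ 0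
  count-incompatible x y i ¬c = count-none (λ C → SizedClosure? k (d ∷ ds) i (x ∷ y ∷ C)) (λ C (_ , cl) → ¬c (proj₂ (IsClosure-∷⁻ d ds x y C cl))) B

  count-in-empty : ∀ y → count (λ C → SizedClosure? k (d ∷ ds) 0 (true ∷ y ∷ C)) B ≡ 0
  count-in-empty y = count-none (λ C → SizedClosure? k (d ∷ ds) 0 (true ∷ y ∷ C)) (λ C (size , _) → ℕ.1+n≢0 size) B


coeff-q*P : ∀ X i → coeff (q *P X) i ≡ coeff (shift X) i
coeff-q*P X i = sym (at (shift≋q*P X) i)

false≢true : false ≢ true
false≢true ()

headedClosures-in-0 : ∀ d ds → headedClosures (d ∷ ds) true 0 ≡ 0
headedClosures-in-0 d ds = trans (headedClosures-split d ds true 0) (cong₂ ℕ._+_ (count-in-empty d ds true) (count-in-empty d ds false))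

headedClosures-right-in : ∀ ds i → headedClosures (right ∷ ds) true (suc i) ≡ headedClosures ds true i
headedClosures-right-in ds i =
  trans (headedClosures-split right ds true (suc i))
        (trans (cong₂ ℕ._+_ (count-in-in right ds true i (λ _ → refl))
                            (count-incompatible right ds true false (suc i) (λ c → false≢true (c refl))))
               (ℕ.+-identityʳ _))

headedClosures-right-out : ∀ ds i → headedClosures (right ∷ ds) false i ≡ headedClosures ds true i ℕ.+ headedClosures ds false i
headedClosures-right-out ds i =
  trans (headedClosures-split right ds false i) (cong₂ ℕ._+_ (count-out right ds true i λ ()) (count-out right ds false i λ ()))

headedClosures-left-in : ∀ ds i → headedClosures (left ∷ ds) true (suc i) ≡ headedClosures ds true i ℕ.+ headedClosures ds false i
headedClosures-left-in ds i =
  trans (headedClosures-split left ds true (suc i))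
        (cong₂ ℕ._+_ (count-in-in left ds true i (λ _ → refl)) (count-in-in left ds false i (λ _ → refl)))

headedClosures-left-out : ∀ ds i → headedClosures (left ∷ ds) false i ≡ headedClosures ds false i
headedClosures-left-out ds i =
  trans (headedClosures-split left ds false i)
        (cong₂ ℕ._+_ (count-incompatible left ds false true i (λ c → false≢true (c refl))) (count-out left ds false i λ ()))

coeff-+P-+ : ∀ p r i {m n} → coeff p i ≡ + m → coeff r i ≡ + n → coeff (p +P r) i ≡ + (m ℕ.+ n)
coeff-+P-+ p r i hp hr = trans (coeff-+P p r i) (cong₂ ℤ._+_ hp hr)

coeff-closurePolys : ∀ ds i → coeff (inPoly ds) i ≡ + headedClosures ds true i
                            × coeff (outPoly ds) i ≡ + headedClosures ds false i
coeff-closurePolys [] zero =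
  cong +_ (sym (count-[-]-no (λ C → SizedClosure? 1 [] 0 (true ∷ C)) {[]} λ { (() , _) })) ,
  cong +_ (sym (count-[-]-yes (λ C → SizedClosure? 1 [] 0 (false ∷ C)) {[]} (refl , IsClosure-[-] false)))
coeff-closurePolys [] (suc zero) =
  cong +_ (sym (count-[-]-yes (λ C → SizedClosure? 1 [] 1 (true ∷ C)) {[]} (refl , IsClosure-[-] true))) ,
  cong +_ (sym (count-[-]-no (λ C → SizedClosure? 1 [] 1 (false ∷ C)) {[]} λ { (() , _) }))
coeff-closurePolys [] (suc (suc i)) =
  cong +_ (sym (count-[-]-no (λ C → SizedClosure? 1 [] (suc (suc i)) (true ∷ C)) {[]} λ { (() , _) })) ,
  cong +_ (sym (count-[-]-no (λ C → SizedClosure? 1 [] (suc (suc i)) (false ∷ C)) {[]} λ { (() , _) }))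
coeff-closurePolys (right ∷ ds) i = coeff-in i , coeff-out
  where
  coeff-in : ∀ i → coeff (q *P inPoly ds) i ≡ + headedClosures (right ∷ ds) true i
  coeff-in zero    = trans (coeff-q*P (inPoly ds) 0) (cong +_ (sym (headedClosures-in-0 right ds)))
  coeff-in (suc i) = trans (coeff-q*P (inPoly ds) (suc i))
                           (trans (proj₁ (coeff-closurePolys ds i)) (cong +_ (sym (headedClosures-right-in ds i))))
  coeff-out : coeff (closurePoly ds) i ≡ + headedClosures (right ∷ ds) false i
  coeff-out = trans (coeff-+P-+ (inPoly ds) (outPoly ds) i (proj₁ (coeff-closurePolys ds i)) (proj₂ (coeff-closurePolys ds i)))
                    (cong +_ (sym (headedClosures-right-out ds i)))
coeff-closurePolys (left ∷ ds) i = coeff-in i , coeff-out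
  where
  coeff-in : ∀ i → coeff (q *P closurePoly ds) i ≡ + headedClosures (left ∷ ds) true i
  coeff-in zero    = trans (coeff-q*P (closurePoly ds) 0) (cong +_ (sym (headedClosures-in-0 left ds)))
  coeff-in (suc i) = trans (coeff-q*P (closurePoly ds) (suc i))
                           (trans (coeff-+P-+ (inPoly ds) (outPoly ds) i (proj₁ (coeff-closurePolys ds i)) (proj₂ (coeff-closurePolys ds i)))
                                  (cong +_ (sym (headedClosures-left-in ds i))))
  coeff-out : coeff (outPoly ds) i ≡ + headedClosures (left ∷ ds) false i
  coeff-out = trans (proj₂ (coeff-closurePolys ds i)) (cong +_ (sym (headedClosures-left-out ds i)))

coeff-closurePoly : ∀ ds i → coeff (closurePoly ds) i ≡ + numClosures (suc (length ds)) ds i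
coeff-closurePoly ds i =
  trans (coeff-+P-+ (inPoly ds) (outPoly ds) i (proj₁ (coeff-closurePolys ds i)) (proj₂ (coeff-closurePolys ds i)))
        (cong +_ (sym (numClosures-split ds i)))

coeff₀-inPoly : ∀ ds → coeff (inPoly ds) 0 ≡ + 0
coeff₀-inPoly []           = refl
coeff₀-inPoly (right ∷ ds) = coeff-q*P (inPoly ds) 0
coeff₀-inPoly (left ∷ ds)  = coeff-q*P (closurePoly ds) 0

coeff₀-outPoly : ∀ ds → coeff (outPoly ds) 0 ≡ + 1
coeff₀-outPoly []           = refl
coeff₀-outPoly (right ∷ ds) = trans (coeff-+P (inPoly ds) (outPoly ds) 0) (cong₂ ℤ._+_ (coeff₀-inPoly ds) (coeff₀-outPoly ds))
coeff₀-outPoly (left ∷ ds)  = coeff₀-outPoly ds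

inPoly-above : ∀ ds j → suc (length ds) < j → coeff (inPoly ds) j ≡ + 0
outPoly-above : ∀ ds j → length ds < j → coeff (outPoly ds) j ≡ + 0

inPoly-above []           (suc zero)    (s≤s ())
inPoly-above []           (suc (suc j)) _         = refl
inPoly-above (right ∷ ds) (suc j)       (s≤s j>n) = trans (coeff-q*P (inPoly ds) (suc j)) (inPoly-above ds j j>n)
inPoly-above (left ∷ ds)  (suc j)       (s≤s j>n) =
  trans (coeff-q*P (closurePoly ds) (suc j))
        (trans (coeff-+P (inPoly ds) (outPoly ds) j)
               (cong₂ ℤ._+_ (inPoly-above ds j j>n) (outPoly-above ds j (ℕ.<⇒≤ j>n))))

outPoly-above []           (suc j) _   = refl
outPoly-above (right ∷ ds) j       j>n =
  trans (coeff-+P (inPoly ds) (outPoly ds) j) (cong₂ ℤ._+_ (inPoly-above ds j j>n) (outPoly-above ds j (ℕ.<⇒≤ j>n)))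
outPoly-above (left ∷ ds)  j       j>n = outPoly-above ds j (ℕ.<⇒≤ j>n)

inPoly-leading : ∀ ds → coeff (inPoly ds) (suc (length ds)) ≡ + 1
inPoly-leading []           = refl
inPoly-leading (right ∷ ds) = trans (coeff-q*P (inPoly ds) _) (inPoly-leading ds)
inPoly-leading (left ∷ ds)  =
  trans (coeff-q*P (closurePoly ds) _)
        (trans (coeff-+P (inPoly ds) (outPoly ds) _)
               (cong₂ ℤ._+_ (inPoly-leading ds) (outPoly-above ds _ ℕ.≤-refl)))

CountsClosures : Poly → ℕ → List Dir → Set
CountsClosures P k ds = (∀ i → coeff P i ≡ + numClosures k ds i)
                        × coeff P 0 ≡ + 1 × coeff P k ≡ + 1 × (∀ i → k < i → coeff P i ≡ + 0)

CountsClosures-≋ : ∀ {P P'} k ds → P ≋ P' → CountsClosures P' k ds → CountsClosures P k ds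
CountsClosures-≋ k ds P≋P' (counts , c₀ , top , above) =
  (λ i → trans (at P≋P' i) (counts i)) , trans (at P≋P' 0) c₀ , trans (at P≋P' _) top
  , (λ i k<i → trans (at P≋P' i) (above i k<i))

closurePoly-counts : ∀ ds → CountsClosures (closurePoly ds) (suc (length ds)) ds
closurePoly-counts ds =
  coeff-closurePoly ds ,
  trans (coeff-+P (inPoly ds) (outPoly ds) 0) (cong₂ ℤ._+_ (coeff₀-inPoly ds) (coeff₀-outPoly ds)) ,
  trans (coeff-+P (inPoly ds) (outPoly ds) _) (cong₂ ℤ._+_ (inPoly-leading ds) (outPoly-above ds _ ℕ.≤-refl)) ,
  (λ j j>n → trans (coeff-+P (inPoly ds) (outPoly ds) j)
                   (cong₂ ℤ._+_ (inPoly-above ds j j>n) (outPoly-above ds j (ℕ.<⇒≤ j>n))))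

oneP-counts : CountsClosures oneP 0 []
oneP-counts = counts , refl , refl , λ { (suc i) _ → refl }
  where
  counts : ∀ i → coeff oneP i ≡ + numClosures 0 [] i
  counts zero    = cong +_ (sym (count-[-]-yes (SizedClosure? 0 [] 0) {[]} (refl , λ ())))
  counts (suc i) = cong +_ (sym (count-[-]-no (SizedClosure? 0 [] (suc i)) {[]} λ { (() , _) }))

-- If the first edge of E points right, the closures avoiding the first vertex are those of the rest.
outPoly-counts : ∀ E → (∀ {d E'} → E ≡ d ∷ E' → d ≡ right) → CountsClosures (outPoly E) (length E) (drop 1 E)
outPoly-counts []            _     = oneP-counts
outPoly-counts (d ∷ E') first with first refl
... | refl = closurePoly-counts E'


length-blocks : ∀ d L → length (blocks d L) ≡ sumL L
length-blocks d []      = refl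
length-blocks d (b ∷ L) =
  trans (List.length-++ (replicate b d)) (cong₂ ℕ._+_ (List.length-replicate b) (length-blocks (flipD d) L))

sumL-decLast : ∀ a L → All (1 ≤_) (a ∷ L) → suc (sumL (decLast (a ∷ L))) ≡ sumL (a ∷ L)
sumL-decLast (suc a) []      _        = refl
sumL-decLast a       (b ∷ L) (_ ∷ ps) = trans (sym (ℕ.+-suc a _)) (cong (a ℕ.+_) (sumL-decLast b L ps))

blocks-right-head : ∀ a L → 1 ≤ a → ∀ {d E'} → blocks right (decLast (a ∷ L)) ≡ d ∷ E' → d ≡ right
blocks-right-head (suc (suc a)) []      _ refl = refl
blocks-right-head (suc a)       (b ∷ L) _ refl = refl

drop-replicate : ∀ a (x : Dir) E → drop (suc a) (replicate a x ++ E) ≡ drop 1 E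
drop-replicate zero    x E = refl
drop-replicate (suc a) x E = drop-replicate a x E

q-cancel : ∀ X Y Z W → (X *P (q *P Y)) ≋ (Z *P (q *P W)) → (X *P Y) ≋ (Z *P W)
q-cancel X Y Z W h = qPow-cancelˡ 1 (begin
  q *P (X *P Y)     ≈⟨ solve 3 (λ q X Y → q :* (X :* Y) := X :* (q :* Y)) ≋-refl q X Y ⟩
  X *P (q *P Y)     ≈⟨ h ⟩
  Z *P (q *P W)     ≈⟨ solve 3 (λ q Z W → Z :* (q :* W) := q :* (Z :* W)) ≋-refl q Z W ⟩
  q *P (Z *P W)     ∎)

1≢2*suc : ∀ m → 1 ≢ 2 * suc m
1≢2*suc m 1≡2m = ℕ.1+n≢0 (sym (trans (ℕ.suc-injective 1≡2m) (ℕ.+-suc m (m ℕ.+ 0))))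

cfq-closurePolys : ∀ a₁ a₂ L (R S : Poly) r → All (1 ≤_) (suc a₁ ∷ a₂ ∷ L) → CoprimeP R S → eval1 R ≡ + r
  → SameFrac R S (cfq (suc a₁ ∷ a₂ ∷ L))
  → (R ≋ closurePoly (replicate a₁ left ++ blocks right (decLast (a₂ ∷ L))))
    × (S ≋ outPoly (replicate a₁ left ++ blocks right (decLast (a₂ ∷ L))))
cfq-closurePolys a₁ a₂ L R S r pos coprime R₁ sf = unique
  where
  E = blocks right (decLast (a₂ ∷ L))
  G = replicate a₁ left ++ E
  cf≃ : Σ ℕ λ t → cfq (suc a₁ ∷ a₂ ∷ L) ≃[ t ] (q *P closurePoly G , q *P outPoly G)
  cf≃ = cfqFrom-≃ true (suc a₁) (a₂ ∷ L) pos
  cross : (R *P outPoly G) ≋ (S *P closurePoly G)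
  cross = q-cancel R (outPoly G) S (closurePoly G)
                   (sameFrac-cross R S (cfq (suc a₁ ∷ a₂ ∷ L)) (proj₁ cf≃) (q *P closurePoly G) (q *P outPoly G) sf (proj₂ cf≃))
  unique : (R ≋ closurePoly G) × (S ≋ outPoly G)
  unique = coprime-cross-unique (inPoly G) (outPoly G) (proj₁ (cofactorPolys G)) (proj₂ (cofactorPolys G)) R S
                                (suc (length G)) r (closurePolys-det G) (proj₁ (proj₂ (closurePoly-counts G)))
                                (λ i → numClosures (suc (length G)) G i , coeff-closurePoly G i) cross coprime R₁

nOf-sizes : ∀ a₁ a₂ L → All (1 ≤_) (a₂ ∷ L)
  → (nOf (suc a₁ ∷ a₂ ∷ L) ∸ 3 ≡ suc (length (replicate a₁ left ++ blocks right (decLast (a₂ ∷ L)))))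
    × (nOf (suc a₁ ∷ a₂ ∷ L) ∸ suc a₁ ∸ 3 ≡ length (blocks right (decLast (a₂ ∷ L))))
nOf-sizes a₁ a₂ L pos = G-size , E-size
  where
  E = blocks right (decLast (a₂ ∷ L))
  e = length E
  sum≡1+e : sumL (a₂ ∷ L) ≡ suc e
  sum≡1+e = trans (sym (sumL-decLast a₂ L pos)) (cong suc (sym (length-blocks right (decLast (a₂ ∷ L)))))
  G-size : nOf (suc a₁ ∷ a₂ ∷ L) ∸ 3 ≡ suc (length (replicate a₁ left ++ E))
  G-size = trans (cong (λ n → (suc a₁ ℕ.+ n) ℕ.+ 2 ∸ 3) sum≡1+e)
           (trans (ℕ.m+n∸n≡m (a₁ ℕ.+ suc e) 2)
           (trans (ℕ.+-suc a₁ e)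
                  (cong suc (sym (trans (List.length-++ (replicate a₁ left)) (cong (ℕ._+ e) (List.length-replicate a₁)))))))
  E-size : nOf (suc a₁ ∷ a₂ ∷ L) ∸ suc a₁ ∸ 3 ≡ e
  E-size = trans (cong (λ n → (suc a₁ ℕ.+ n) ℕ.+ 2 ∸ suc a₁ ∸ 3) sum≡1+e)
           (trans (cong (_∸ 3) (trans (cong (_∸ suc a₁) (ℕ.+-assoc (suc a₁) (suc e) 2)) (ℕ.m+n∸m≡n (suc a₁) (suc e ℕ.+ 2))))
                  (ℕ.m+n∸n≡m e 2))

theorem3p5 : (as : List ℕ) (m r s : ℕ) (R S : Poly)
    → All (1 ≤_) as → 1 ≤ m → length as ≡ 2 * m
    → Coprime r s → s < r
    → r * proj₂ (cf as) ≡ s * proj₁ (cf as)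
    → CoprimeP R S → eval1 R ≡ + r → eval1 S ≡ + s
    → SameFrac R S (cfq as)
    → ((∀ i → coeff R i ≡ + numClosures (nOf as ∸ 3) (dirsG as) i)
       × coeff R 0 ≡ + 1 × coeff R (nOf as ∸ 3) ≡ + 1
       × (∀ i → nOf as ∸ 3 < i → coeff R i ≡ + 0))
      × ((∀ i → coeff S i ≡ + numClosures (nOf as ∸ headOr0 as ∸ 3) (dirsG' as) i)
       × coeff S 0 ≡ + 1 × coeff S (nOf as ∸ headOr0 as ∸ 3) ≡ + 1
       × (∀ i → nOf as ∸ headOr0 as ∸ 3 < i → coeff S i ≡ + 0))
theorem3p5 []                _ _ _ _ _ _ (s≤s _) ()
theorem3p5 (_ ∷ [])          _ _ _ _ _ _ (s≤s {n = m} _) 1≡2m = ⊥-elim (1≢2*suc m 1≡2m)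
theorem3p5 (suc a₁ ∷ a₂ ∷ L) _ r _ R S pos@(_ ∷ a₂≥1 ∷ as≥1) _ _ _ _ _ coprime R₁ _ sf =
  subst (λ k → CountsClosures R k G) (sym (proj₁ sizes))
        (CountsClosures-≋ (suc (length G)) G (proj₁ fraction) (closurePoly-counts G)) ,
  subst₂ (CountsClosures S) (sym (proj₂ sizes)) (sym (drop-replicate a₁ left E))
         (CountsClosures-≋ (length E) (drop 1 E) (subst (S ≋_) (outPoly-lefts a₁ E) (proj₂ fraction))
                           (outPoly-counts E (blocks-right-head a₂ L a₂≥1)))
  where
  E = blocks right (decLast (a₂ ∷ L))
  G = replicate a₁ left ++ E
  fraction : (R ≋ closurePoly G) × (S ≋ outPoly G)
  fraction = cfq-closurePolys a₁ a₂ L R S r pos coprime R₁ sf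
  sizes : (nOf (suc a₁ ∷ a₂ ∷ L) ∸ 3 ≡ suc (length G)) × (nOf (suc a₁ ∷ a₂ ∷ L) ∸ suc a₁ ∸ 3 ≡ length E)
  sizes = nOf-sizes a₁ a₂ L (a₂≥1 ∷ as≥1)
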